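{- Let $a,k,m,n$ be positive integers with $a$ odd. Then $$N(a,a,2k,2m;2n)=N(a,a,k,m;n).$$
   Context: For positive integers $a,b,c,d$ and an integer $n\ge 0$, $N(a,b,c,d;n)$ denotes the number of $(x,y,z,w)\in\mathbb Z^4$ with $n=ax^2+by^2+cz^2+dw^2$. -}

module Defs where

open import Data.Nat using (ℕ; suc; _+_; _*_)
open import Data.Nat.Properties using (_≟_)
open import Data.Integer as ℤ using (ℤ; +_)
open import Data.List using (List; map; concatMap; length; filter; applyUpTo; _++_)
open import Data.Product using (_×_; _,_)

-- The integers in the interval [-B, B] (each listed exactly once).
range : ℕ → List ℤ
range B = map (λ i → ℤ.- (+ suc i)) (applyUpTo (λ i → i) B) ++ applyUpTo +_ (suc B)

form : ℕ → ℕ → ℕ → ℕ → ℤ → ℤ → ℤ → ℤ → ℕ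
form a b c d x y z w =
  a * (ℤ.∣ x ∣ * ℤ.∣ x ∣) + b * (ℤ.∣ y ∣ * ℤ.∣ y ∣)
    + c * (ℤ.∣ z ∣ * ℤ.∣ z ∣) + d * (ℤ.∣ w ∣ * ℤ.∣ w ∣)

box : ℕ → List (ℤ × ℤ × ℤ × ℤ)
box B = concatMap (λ x → concatMap (λ y → concatMap (λ z → map (λ w → (x , y , z , w))
          (range B)) (range B)) (range B)) (range B)

-- N(a,b,c,d;n) = #{(x,y,z,w) ∈ ℤ^4 : n = a x² + b y² + c z² + d w²}.
-- For positive a,b,c,d every solution satisfies |x|,|y|,|z|,|w| ≤ n, so the
-- solutions are exactly the entries of box n satisfying the equation.
N : ℕ → ℕ → ℕ → ℕ → ℕ → ℕ
N a b c d n = length (filter (λ { (x , y , z , w) → n ≟ form a b c d x y z w }) (box n))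

module Submission where

-- The substitution σ(u,v,z,w) = (u+v, u−v, z, w) satisfies
--   a(u+v)² + a(u−v)² + 2k z² + 2m w² = 2 (a u² + a v² + k z² + m w²),
-- so σ maps solutions of a u² + a v² + k z² + m w² = n injectively to
-- solutions of a x² + a y² + 2k z² + 2m w² = 2n.  It is onto: writing
-- x² + y² = (x+y)² − 2xy, a solution (x,y,z,w) of the second equation has
-- a (x+y)² even, and since a is odd and 2 is prime, x + y = 2t; then
-- (x,y,z,w) = σ(t, x−t, z, w).

open import Defs
open import Data.Nat using (ℕ; _*_; _<_)
open import Data.Nat.Divisibility using (_∣_)
open import Relation.Nullary using (¬_)
open import Relation.Binary.PropositionalEquality using (_≡_)

open import Data.Nat using (zero; suc; _+_; _≤_; z≤n; s≤s; >-nonZero)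
import Data.Nat.Properties as ℕP
open import Data.Nat.Divisibility using (divides)
open import Data.Nat.Primality using (Prime; prime?; euclidsLemma)
open import Data.Integer using (ℤ; +_; -[1+_]; ∣_∣)
import Data.Integer as ℤ
import Data.Integer.Properties as ℤP
open import Data.Integer.Divisibility.Signed using (∣ᵤ⇒∣) renaming (_∣_ to _∣ℤ_; divides to dividesℤ)
open import Data.Integer.Tactic.RingSolver using (solve-∀)
open import Data.List using (List; []; _∷_; map; concatMap; length; filter; applyUpTo; _++_; cartesianProduct)
import Data.List.Properties as LP
open import Data.List.Membership.Propositional using (_∈_)
open import Data.List.Membership.Propositional.Properties
  using (∈-filter⁺; ∈-filter⁻; ∈-map⁺; ∈-map⁻; ∈-++⁺ˡ; ∈-++⁺ʳ; ∈-applyUpTo⁺; ∈-applyUpTo⁻; ∈-cartesianProduct⁺)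
open import Data.List.Membership.Propositional.Properties.WithK using (unique∧set⇒bag)
open import Data.List.Relation.Unary.Unique.Propositional using (Unique)
import Data.List.Relation.Unary.Unique.Propositional.Properties as Unique
open import Data.List.Relation.Binary.BagAndSetEquality using (∼bag⇒↭)
open import Data.List.Relation.Binary.Permutation.Propositional.Properties using (↭-length)
open import Data.Product using (_×_; _,_; ∃; proj₁; proj₂)
open import Data.Sum using (inj₁; inj₂; reduce)
open import Function using (id)
open import Function.Bundles using (mk⇔)
open import Function.Definitions using (Injective)
open import Level using (0ℓ)
open import Relation.Nullary using (contradiction)
open import Relation.Nullary.Decidable using (from-yes)
open import Relation.Unary using (Pred; Decidable)
open import Relation.Binary.PropositionalEquality using (refl; sym; trans; cong; cong₂; subst; module ≡-Reasoning)

count-bijection : {A B : Set} {P : Pred A 0ℓ} {Q : Pred B 0ℓ}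
  (P? : Decidable P) (Q? : Decidable Q) {xs : List A} {ys : List B}
  (g : B → A) → Injective _≡_ _≡_ g → Unique xs → Unique ys →
  (∀ {x} → P x → x ∈ xs) → (∀ {y} → Q y → y ∈ ys) →
  (∀ {y} → Q y → P (g y)) → (∀ {x} → P x → ∃ λ y → Q y × g y ≡ x) →
  length (filter P? xs) ≡ length (filter Q? ys)
count-bijection P? Q? {xs} {ys} g g-inj xs-unique ys-unique P⊆xs Q⊆ys maps-to onto =
  trans (↭-length (∼bag⇒↭ (unique∧set⇒bag
          (Unique.filter⁺ P? {xs} xs-unique) (Unique.map⁺ g-inj (Unique.filter⁺ Q? {ys} ys-unique))
          (mk⇔ to from))))
        (LP.length-map g (filter Q? ys))
  where
  to : ∀ {x} → x ∈ filter P? xs → x ∈ map g (filter Q? ys)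
  to x∈ with onto (proj₂ (∈-filter⁻ P? {xs = xs} x∈))
  ... | y , Qy , refl = ∈-map⁺ g (∈-filter⁺ Q? (Q⊆ys Qy) Qy)
  from : ∀ {x} → x ∈ map g (filter Q? ys) → x ∈ filter P? xs
  from x∈ with ∈-map⁻ g x∈
  ... | y , y∈ , refl with ∈-filter⁻ Q? {xs = ys} y∈
  ... | _ , Qy = ∈-filter⁺ P? (P⊆xs (maps-to Qy)) (maps-to Qy)

range-complete : ∀ B x → ∣ x ∣ ≤ B → x ∈ range B
range-complete B (+ i) i≤B =
  ∈-++⁺ʳ (map (λ i → ℤ.- (+ suc i)) (applyUpTo id B)) (∈-applyUpTo⁺ +_ (s≤s i≤B))
range-complete B -[1+ i ] i<B = ∈-++⁺ˡ (∈-map⁺ (λ i → ℤ.- (+ suc i)) (∈-applyUpTo⁺ id i<B))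

range-unique : ∀ B → Unique (range B)
range-unique B = Unique.++⁺
  (Unique.map⁺ negsuc-injective (Unique.applyUpTo⁺₁ id B (λ i<j _ → ℕP.<⇒≢ i<j)))
  (Unique.applyUpTo⁺₁ +_ (suc B) (λ i<j _ eq → ℕP.<⇒≢ i<j (ℤP.+-injective eq)))
  negatives-disjoint-from-naturals
  where
  negsuc-injective : ∀ {i j} → ℤ.- (+ suc i) ≡ ℤ.- (+ suc j) → i ≡ j
  negsuc-injective refl = refl
  negatives-disjoint-from-naturals : ∀ {x} →
    ¬ (x ∈ map (λ i → ℤ.- (+ suc i)) (applyUpTo id B) × x ∈ applyUpTo +_ (suc B))
  negatives-disjoint-from-naturals (x∈neg , x∈nat) with ∈-map⁻ (λ i → ℤ.- (+ suc i)) x∈neg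
  ... | _ , _ , refl with ∈-applyUpTo⁻ +_ x∈nat
  ... | _ , _ , ()

concatMap-pairs : {A B C : Set} (h : A × B → C) (xs : List A) (ys : List B) →
  concatMap (λ x → map (λ y → h (x , y)) ys) xs ≡ map h (cartesianProduct xs ys)
concatMap-pairs h [] ys = refl
concatMap-pairs h (x ∷ xs) ys = begin
  map (λ y → h (x , y)) ys ++ concatMap (λ x → map (λ y → h (x , y)) ys) xs
    ≡⟨ cong₂ _++_ (LP.map-∘ ys) (concatMap-pairs h xs ys) ⟩
  map h (map (x ,_) ys) ++ map h (cartesianProduct xs ys)
    ≡⟨ LP.map-++ h (map (x ,_) ys) (cartesianProduct xs ys) ⟨
  map h (cartesianProduct (x ∷ xs) ys) ∎
  where open ≡-Reasoning

box-product : ∀ B → box B ≡ cartesianProduct (range B) (cartesianProduct (range B) (cartesianProduct (range B) (range B)))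
box-product B = begin
  box B
    ≡⟨ LP.concatMap-cong (λ x → LP.concatMap-cong (λ y → concatMap-pairs (λ p → x , y , p) R R) R) R ⟩
  concatMap (λ x → concatMap (λ y → map (λ p → x , y , p) (cartesianProduct R R)) R) R
    ≡⟨ LP.concatMap-cong (λ x → concatMap-pairs (x ,_) R (cartesianProduct R R)) R ⟩
  concatMap (λ x → map (x ,_) (cartesianProduct R (cartesianProduct R R))) R
    ≡⟨ concatMap-pairs id R (cartesianProduct R (cartesianProduct R R)) ⟩
  map id (cartesianProduct R (cartesianProduct R (cartesianProduct R R)))
    ≡⟨ LP.map-id _ ⟩
  cartesianProduct R (cartesianProduct R (cartesianProduct R R)) ∎
  where
  open ≡-Reasoning
  R = range B

box-unique : ∀ B → Unique (box B)
box-unique B rewrite box-product B =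
  Unique.cartesianProduct⁺ (range-unique B)
    (Unique.cartesianProduct⁺ (range-unique B) (Unique.cartesianProduct⁺ (range-unique B) (range-unique B)))

box-complete : ∀ B x y z w → ∣ x ∣ ≤ B → ∣ y ∣ ≤ B → ∣ z ∣ ≤ B → ∣ w ∣ ≤ B → (x , y , z , w) ∈ box B
box-complete B x y z w bx by bz bw = subst ((x , y , z , w) ∈_) (sym (box-product B))
  (∈-cartesianProduct⁺ (range-complete B x bx) (∈-cartesianProduct⁺ (range-complete B y by)
    (∈-cartesianProduct⁺ (range-complete B z bz) (range-complete B w bw))))

-- Quadruples, and the quadruples counted by N a b c d n.  (This is, up to
-- definitional equality, the predicate filtered in the definition of N.)
Q4 : Set
Q4 = ℤ × ℤ × ℤ × ℤ

Solution : ℕ → ℕ → ℕ → ℕ → ℕ → Q4 → Set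
Solution a b c d n (x , y , z , w) = n ≡ form a b c d x y z w

-- Positivity of all four coefficients makes the solution set finite.
Positive : ℕ → ℕ → ℕ → ℕ → Set
Positive a b c d = 0 < a × 0 < b × 0 < c × 0 < d

coordinate-bound : ∀ e t → 0 < e → t ≤ e * (t * t)
coordinate-bound e zero    _   = z≤n
coordinate-bound e (suc t) 0<e =
  ℕP.≤-trans (ℕP.m≤m*n (suc t) (suc t)) (ℕP.m≤n*m _ e {{>-nonZero 0<e}})

solution∈box : ∀ {a b c d n} q → Positive a b c d → Solution a b c d n q → q ∈ box n
solution∈box {a} {b} {c} {d} (x , y , z , w) (0<a , 0<b , 0<c , 0<d) refl =
  box-complete _ x y z w
    (ℕP.≤-trans (coordinate-bound a ∣ x ∣ 0<a)
      (ℕP.m≤n⇒m≤n+o D (ℕP.m≤n⇒m≤n+o C (ℕP.m≤m+n A B))))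
    (ℕP.≤-trans (coordinate-bound b ∣ y ∣ 0<b)
      (ℕP.m≤n⇒m≤n+o D (ℕP.m≤n⇒m≤n+o C (ℕP.m≤n+m B A))))
    (ℕP.≤-trans (coordinate-bound c ∣ z ∣ 0<c) (ℕP.m≤n⇒m≤n+o D (ℕP.m≤n+m C (A + B))))
    (ℕP.≤-trans (coordinate-bound d ∣ w ∣ 0<d) (ℕP.m≤n+m D (A + B + C)))
  where
  A = a * (∣ x ∣ * ∣ x ∣)
  B = b * (∣ y ∣ * ∣ y ∣)
  C = c * (∣ z ∣ * ∣ z ∣)
  D = d * (∣ w ∣ * ∣ w ∣)

N-transport : ∀ {a b c d a′ b′ c′ d′} n n′ →
  Positive a b c d → Positive a′ b′ c′ d′ → (g : Q4 → Q4) → Injective _≡_ _≡_ g →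
  (∀ {q} → Solution a b c d n q → Solution a′ b′ c′ d′ n′ (g q)) →
  (∀ {q′} → Solution a′ b′ c′ d′ n′ q′ → ∃ λ q → Solution a b c d n q × g q ≡ q′) →
  N a′ b′ c′ d′ n′ ≡ N a b c d n
N-transport n n′ pos pos′ g g-inj maps-to onto =
  count-bijection _ _ g g-inj (box-unique n′) (box-unique n)
    (λ {q} → solution∈box q pos′) (λ {q} → solution∈box q pos) maps-to onto

formℤ : ℤ → ℤ → ℤ → ℤ → ℤ → ℤ → ℤ → ℤ → ℤ
formℤ a b c d x y z w =
  a ℤ.* (x ℤ.* x) ℤ.+ b ℤ.* (y ℤ.* y) ℤ.+ c ℤ.* (z ℤ.* z) ℤ.+ d ℤ.* (w ℤ.* w)

form-ℤ : ∀ a b c d x y z w → + form a b c d x y z w ≡ formℤ (+ a) (+ b) (+ c) (+ d) x y z w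
form-ℤ a b c d x y z w =
  trans (ℤP.pos-+ (A + B + C) D) (cong₂ ℤ._+_
    (trans (ℤP.pos-+ (A + B) C) (cong₂ ℤ._+_
      (trans (ℤP.pos-+ A B) (cong₂ ℤ._+_ (term a x) (term b y))) (term c z))) (term d w))
  where
  A = a * (∣ x ∣ * ∣ x ∣)
  B = b * (∣ y ∣ * ∣ y ∣)
  C = c * (∣ z ∣ * ∣ z ∣)
  D = d * (∣ w ∣ * ∣ w ∣)
  abs-square : ∀ v → + (∣ v ∣ * ∣ v ∣) ≡ v ℤ.* v
  abs-square (+ i)    = ℤP.pos-* i i
  abs-square -[1+ i ] = refl
  term : ∀ e v → + (e * (∣ v ∣ * ∣ v ∣)) ≡ + e ℤ.* (v ℤ.* v)
  term e v = trans (ℤP.pos-* e _) (cong (+ e ℤ.*_) (abs-square v))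

form-ℤ-doubled : ∀ a k m x y z w →
  + form a a (2 * k) (2 * m) x y z w ≡ formℤ (+ a) (+ a) (+ 2 ℤ.* + k) (+ 2 ℤ.* + m) x y z w
form-ℤ-doubled a k m x y z w =
  trans (form-ℤ a a (2 * k) (2 * m) x y z w)
        (cong₂ (λ K M → formℤ (+ a) (+ a) K M x y z w) (ℤP.pos-* 2 k) (ℤP.pos-* 2 m))

σ : Q4 → Q4
σ (u , v , z , w) = (u ℤ.+ v , u ℤ.- v , z , w)

-- σ is injective: u and v are recovered from 2u = x + y and 2v = x − y.
σ-injective : Injective _≡_ _≡_ σ
σ-injective {u , v , z , w} {u′ , v′ , z′ , w′} eq =
  cong₂ _,_ (ℤP.*-cancelˡ-≡ (+ 2) u u′ twice-u)
    (cong₂ _,_ (ℤP.*-cancelˡ-≡ (+ 2) v v′ twice-v) (cong (λ q → proj₂ (proj₂ q)) eq))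
  where
  open ≡-Reasoning
  sum≡ : u ℤ.+ v ≡ u′ ℤ.+ v′
  sum≡ = cong proj₁ eq
  diff≡ : u ℤ.- v ≡ u′ ℤ.- v′
  diff≡ = cong (λ q → proj₁ (proj₂ q)) eq
  twice-first : ∀ s t → + 2 ℤ.* s ≡ (s ℤ.+ t) ℤ.+ (s ℤ.- t)
  twice-first = solve-∀
  twice-second : ∀ s t → + 2 ℤ.* t ≡ (s ℤ.+ t) ℤ.- (s ℤ.- t)
  twice-second = solve-∀
  twice-u : + 2 ℤ.* u ≡ + 2 ℤ.* u′
  twice-u = begin
    + 2 ℤ.* u                         ≡⟨ twice-first u v ⟩
    (u ℤ.+ v) ℤ.+ (u ℤ.- v)           ≡⟨ cong₂ ℤ._+_ sum≡ diff≡ ⟩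
    (u′ ℤ.+ v′) ℤ.+ (u′ ℤ.- v′)       ≡⟨ twice-first u′ v′ ⟨
    + 2 ℤ.* u′                        ∎
  twice-v : + 2 ℤ.* v ≡ + 2 ℤ.* v′
  twice-v = begin
    + 2 ℤ.* v                         ≡⟨ twice-second u v ⟩
    (u ℤ.+ v) ℤ.- (u ℤ.- v)           ≡⟨ cong₂ ℤ._-_ sum≡ diff≡ ⟩
    (u′ ℤ.+ v′) ℤ.- (u′ ℤ.- v′)       ≡⟨ twice-second u′ v′ ⟨
    + 2 ℤ.* v′                        ∎

formℤ-σ : ∀ A K M u v z w →
  formℤ A A (+ 2 ℤ.* K) (+ 2 ℤ.* M) (u ℤ.+ v) (u ℤ.- v) z w ≡ + 2 ℤ.* formℤ A A K M u v z w
formℤ-σ = doubling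
  where
  doubling : ∀ A K M u v z w →
    A ℤ.* ((u ℤ.+ v) ℤ.* (u ℤ.+ v)) ℤ.+ A ℤ.* ((u ℤ.- v) ℤ.* (u ℤ.- v))
      ℤ.+ (+ 2 ℤ.* K) ℤ.* (z ℤ.* z) ℤ.+ (+ 2 ℤ.* M) ℤ.* (w ℤ.* w)
    ≡ + 2 ℤ.* (A ℤ.* (u ℤ.* u) ℤ.+ A ℤ.* (v ℤ.* v) ℤ.+ K ℤ.* (z ℤ.* z) ℤ.+ M ℤ.* (w ℤ.* w))
  doubling = solve-∀

form-σ : ∀ a k m u v z w →
  form a a (2 * k) (2 * m) (u ℤ.+ v) (u ℤ.- v) z w ≡ 2 * form a a k m u v z w
form-σ a k m u v z w = ℤP.+-injective (begin
  + form a a (2 * k) (2 * m) (u ℤ.+ v) (u ℤ.- v) z w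
    ≡⟨ form-ℤ-doubled a k m (u ℤ.+ v) (u ℤ.- v) z w ⟩
  formℤ (+ a) (+ a) (+ 2 ℤ.* + k) (+ 2 ℤ.* + m) (u ℤ.+ v) (u ℤ.- v) z w
    ≡⟨ formℤ-σ (+ a) (+ k) (+ m) u v z w ⟩
  + 2 ℤ.* formℤ (+ a) (+ a) (+ k) (+ m) u v z w
    ≡⟨ cong (+ 2 ℤ.*_) (form-ℤ a a k m u v z w) ⟨
  + 2 ℤ.* + form a a k m u v z w
    ≡⟨ ℤP.pos-* 2 (form a a k m u v z w) ⟨
  + (2 * form a a k m u v z w) ∎)
  where open ≡-Reasoning

σ-maps-to : ∀ a k m n {q} → Solution a a k m n q → Solution a a (2 * k) (2 * m) (2 * n) (σ q)
σ-maps-to a k m n {u , v , z , w} sol = trans (cong (2 *_) sol) (sym (form-σ a k m u v z w))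

σ-reflects : ∀ a k m n {q} → Solution a a (2 * k) (2 * m) (2 * n) (σ q) → Solution a a k m n q
σ-reflects a k m n {u , v , z , w} sol = ℕP.*-cancelˡ-≡ n _ 2 (trans sol (form-σ a k m u v z w))

formℤ-split : ∀ A K M x y z w →
  formℤ A A (+ 2 ℤ.* K) (+ 2 ℤ.* M) x y z w
    ≡ A ℤ.* ((x ℤ.+ y) ℤ.* (x ℤ.+ y)) ℤ.+ + 2 ℤ.* (K ℤ.* (z ℤ.* z) ℤ.+ M ℤ.* (w ℤ.* w) ℤ.- A ℤ.* (x ℤ.* y))
formℤ-split = split
  where
  split : ∀ A K M x y z w →
    A ℤ.* (x ℤ.* x) ℤ.+ A ℤ.* (y ℤ.* y) ℤ.+ (+ 2 ℤ.* K) ℤ.* (z ℤ.* z) ℤ.+ (+ 2 ℤ.* M) ℤ.* (w ℤ.* w)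
      ≡ A ℤ.* ((x ℤ.+ y) ℤ.* (x ℤ.+ y)) ℤ.+ + 2 ℤ.* (K ℤ.* (z ℤ.* z) ℤ.+ M ℤ.* (w ℤ.* w) ℤ.- A ℤ.* (x ℤ.* y))
  split = solve-∀

even-difference : ∀ P E N → P ℤ.+ + 2 ℤ.* E ≡ + 2 ℤ.* N → P ≡ (N ℤ.- E) ℤ.* + 2
even-difference P E N eq = begin
  P                                   ≡⟨ remove-even P E ⟩
  (P ℤ.+ + 2 ℤ.* E) ℤ.- + 2 ℤ.* E     ≡⟨ cong (ℤ._- + 2 ℤ.* E) eq ⟩
  + 2 ℤ.* N ℤ.- + 2 ℤ.* E             ≡⟨ factor-two N E ⟩
  (N ℤ.- E) ℤ.* + 2                   ∎
  where
  open ≡-Reasoning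
  remove-even : ∀ P E → P ≡ (P ℤ.+ + 2 ℤ.* E) ℤ.- + 2 ℤ.* E
  remove-even = solve-∀
  factor-two : ∀ N E → + 2 ℤ.* N ℤ.- + 2 ℤ.* E ≡ (N ℤ.- E) ℤ.* + 2
  factor-two = solve-∀

two-is-prime : Prime 2
two-is-prime = from-yes (prime? 2)

odd-times-square : ∀ a t → ¬ 2 ∣ a → 2 ∣ a * (t * t) → 2 ∣ t
odd-times-square a t a-odd 2∣at² with euclidsLemma a (t * t) two-is-prime 2∣at²
... | inj₁ 2∣a  = contradiction 2∣a a-odd
... | inj₂ 2∣t² = reduce (euclidsLemma t t two-is-prime 2∣t²)

solution-sum-even : ∀ a k m n x y z w → ¬ 2 ∣ a →
  Solution a a (2 * k) (2 * m) (2 * n) (x , y , z , w) → + 2 ∣ℤ x ℤ.+ y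
solution-sum-even a k m n x y z w a-odd sol =
  ∣ᵤ⇒∣ (odd-times-square a ∣ s ∣ a-odd (divides ∣ n′ ℤ.- E ∣ (begin
    a * (∣ s ∣ * ∣ s ∣)               ≡⟨ cong (a *_) (ℤP.abs-* s s) ⟨
    a * ∣ s ℤ.* s ∣                   ≡⟨ ℤP.abs-* (+ a) (s ℤ.* s) ⟨
    ∣ + a ℤ.* (s ℤ.* s) ∣             ≡⟨ cong ∣_∣ (even-difference (+ a ℤ.* (s ℤ.* s)) E n′ split-sol) ⟩
    ∣ (n′ ℤ.- E) ℤ.* + 2 ∣            ≡⟨ ℤP.abs-* (n′ ℤ.- E) (+ 2) ⟩
    ∣ n′ ℤ.- E ∣ * 2                  ∎)))
  where
  open ≡-Reasoning
  s = x ℤ.+ y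
  n′ = + n
  E = + k ℤ.* (z ℤ.* z) ℤ.+ + m ℤ.* (w ℤ.* w) ℤ.- + a ℤ.* (x ℤ.* y)
  split-sol : + a ℤ.* (s ℤ.* s) ℤ.+ + 2 ℤ.* E ≡ + 2 ℤ.* n′
  split-sol = begin
    + a ℤ.* (s ℤ.* s) ℤ.+ + 2 ℤ.* E
      ≡⟨ formℤ-split (+ a) (+ k) (+ m) x y z w ⟨
    formℤ (+ a) (+ a) (+ 2 ℤ.* + k) (+ 2 ℤ.* + m) x y z w
      ≡⟨ form-ℤ-doubled a k m x y z w ⟨
    + form a a (2 * k) (2 * m) x y z w
      ≡⟨ cong +_ sol ⟨
    + (2 * n)
      ≡⟨ ℤP.pos-* 2 n ⟩
    + 2 ℤ.* n′ ∎

σ-preimage : ∀ x y z w t → x ℤ.+ y ≡ t ℤ.* + 2 → σ (t , x ℤ.- t , z , w) ≡ (x , y , z , w)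
σ-preimage x y z w t x+y≡2t = cong₂ (λ p q → p , q , z , w) (first x t) (begin
  t ℤ.- (x ℤ.- t)          ≡⟨ second x t ⟩
  t ℤ.* + 2 ℤ.- x          ≡⟨ cong (ℤ._- x) x+y≡2t ⟨
  x ℤ.+ y ℤ.- x            ≡⟨ cancel x y ⟩
  y                        ∎)
  where
  open ≡-Reasoning
  first : ∀ x t → t ℤ.+ (x ℤ.- t) ≡ x
  first = solve-∀
  second : ∀ x t → t ℤ.- (x ℤ.- t) ≡ t ℤ.* + 2 ℤ.- x
  second = solve-∀
  cancel : ∀ x y → x ℤ.+ y ℤ.- x ≡ y
  cancel = solve-∀

σ-onto : ∀ a k m n → ¬ 2 ∣ a → ∀ {q′} → Solution a a (2 * k) (2 * m) (2 * n) q′ →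
  ∃ λ q → Solution a a k m n q × σ q ≡ q′
σ-onto a k m n a-odd {x , y , z , w} sol with solution-sum-even a k m n x y z w a-odd sol
... | dividesℤ t x+y≡2t =
  q , σ-reflects a k m n {q} (subst (Solution a a (2 * k) (2 * m) (2 * n)) (sym σq≡) sol) , σq≡
  where
  q : Q4
  q = (t , x ℤ.- t , z , w)
  σq≡ : σ q ≡ (x , y , z , w)
  σq≡ = σ-preimage x y z w t x+y≡2t

lemma2p1 : (a k m n : ℕ) → 0 < a → 0 < k → 0 < m → 0 < n → ¬ (2 ∣ a) →
    N a a (2 * k) (2 * m) (2 * n) ≡ N a a k m n
lemma2p1 a k m n 0<a 0<k 0<m _ a-odd =
  N-transport n (2 * n) (0<a , 0<a , 0<k , 0<m) (0<a , 0<a , ℕP.*-monoʳ-< 2 0<k , ℕP.*-monoʳ-< 2 0<m)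
    σ σ-injective (λ {q} → σ-maps-to a k m n {q}) (λ {q} → σ-onto a k m n a-odd {q})
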